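{- For an integer $x\ge 2$ let $n=4x+4$ and let $\mathcal{S}=\mathcal{S}^{(x)}=\{S_0,\ldots,S_{n+2}\}\subseteq\mathcal{P}([n])$ be the family $S_0=[n]$; $S_1=\{2,\tfrac n2+1,\ldots,n\}$; $S_2=\{1,3,\ldots,\tfrac n2,n\}$; $S_3=\{1,4,\ldots,\tfrac n2+2\}$; $S_4=\{1,3,\tfrac n2+3,\ldots,n\}$; $S_{k}=\{1,4,k+1,\ldots,\tfrac n2+k-2\}$ for $5\le k\le \tfrac n4+2$; $S_{k}=\{1,4,k+1,\ldots,\tfrac n2+k-3\}$ for $\tfrac n4+3\le k\le \tfrac n2$; $S_{\frac n2+1}=\{2,4,\tfrac n2+2,\ldots,n-2\}$; $S_{\frac n2+2}=\{2,4,\tfrac n2+3,\ldots,n-1\}$; $S_{\frac n2+3}=\{2,3,\tfrac n2+4,\ldots,n\}$; $S_{k}=\{2,3,5,\ldots,k-\tfrac n2+1,k+1,\ldots,n\}$ for $\tfrac n2+4\le k\le \tfrac{3n}4$; $S_{\frac{3n}4+1}=\{2,3,5,\ldots,\tfrac n4+3,\tfrac{3n}4+2,\ldots,n-1\}$; $S_{k}=\{2,3,5,\ldots,k-\tfrac n2+2,k+1,\ldots,n\}$ for $\tfrac{3n}4+2\le k\le n-1$; $S_n=\{3,5,\ldots,\tfrac n2+2,\tfrac{3n}4+1\}$; $S_{n+1}=\{\tfrac{3n}4+2,\ldots,n\}$; $S_{n+2}=\{1,5,\ldots,\tfrac n4+2\}$. Then $|cl(\mathcal{S})|=\Theta(n^2)$;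 that is, there are constants $c,C>0$ such that $c\,n^2\le |cl(\mathcal{S}^{(x)})|\le C\,n^2$ for all $x\ge 2$.
   Context: $[n]=\{1,\ldots,n\}$. A notation $\{\ldots,a,\ldots,b,\ldots\}$ with $a\le b$ means all consecutive integers from $a$ to $b$ are included (empty range if $b<a$). For a family $\mathcal{S}$ of sets, $cl(\mathcal{S})$ denotes its union closure: $A\in cl(\mathcal{S})$ iff $A=\bigcup_{B\in\mathcal{T}}B$ for some subfamily $\mathcal{T}\subseteq\mathcal{S}$. -}

module Defs where

open import Data.Nat using (ℕ; suc; _+_; _*_; _∸_; _≤ᵇ_; _≡ᵇ_)
open import Data.Bool using (Bool; true; false; _∧_; _∨_; if_then_else_)
open import Data.Fin using (Fin; toℕ)
open import Data.Fin.Subset using (Subset; inside; outside; ⋃)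
open import Data.Fin.Subset.Properties using (_∈?_)
open import Data.List using (List; map; filter; allFin)
open import Data.Vec using (tabulate)
open import Data.Product using (∃)
open import Relation.Binary.PropositionalEquality using (_≡_)

-- Ground set [n] = {1,…,n} with n = 4x+4.  The element j ∈ [n] is encoded
-- as the index (j-1) : Fin n of a Subset n (1-based paper labels, 0-based Fin).
nn : ℕ → ℕ
nn x = 4 * x + 4

inR : ℕ → ℕ → ℕ → Bool
inR a b j = (a ≤ᵇ j) ∧ (j ≤ᵇ b)

memb : (x k j : ℕ) → Bool
memb x k j =
  if k ≡ᵇ 0 then inR 1 n j
  else if k ≡ᵇ 1 then (j ≡ᵇ 2) ∨ inR (h + 1) n j
  else if k ≡ᵇ 2 then (j ≡ᵇ 1) ∨ inR 3 h j ∨ (j ≡ᵇ n)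
  else if k ≡ᵇ 3 then (j ≡ᵇ 1) ∨ inR 4 (h + 2) j
  else if k ≡ᵇ 4 then (j ≡ᵇ 1) ∨ (j ≡ᵇ 3) ∨ inR (h + 3) n j
  else if inR 5 (q + 2) k then (j ≡ᵇ 1) ∨ (j ≡ᵇ 4) ∨ inR (k + 1) (h + k ∸ 2) j
  else if inR (q + 3) h k then (j ≡ᵇ 1) ∨ (j ≡ᵇ 4) ∨ inR (k + 1) (h + k ∸ 3) j
  else if k ≡ᵇ h + 1 then (j ≡ᵇ 2) ∨ (j ≡ᵇ 4) ∨ inR (h + 2) (n ∸ 2) j
  else if k ≡ᵇ h + 2 then (j ≡ᵇ 2) ∨ (j ≡ᵇ 4) ∨ inR (h + 3) (n ∸ 1) j
  else if k ≡ᵇ h + 3 then (j ≡ᵇ 2) ∨ (j ≡ᵇ 3) ∨ inR (h + 4) n j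
  else if inR (h + 4) t k then (j ≡ᵇ 2) ∨ (j ≡ᵇ 3) ∨ inR 5 (k ∸ h + 1) j ∨ inR (k + 1) n j
  else if k ≡ᵇ t + 1 then (j ≡ᵇ 2) ∨ (j ≡ᵇ 3) ∨ inR 5 (q + 3) j ∨ inR (t + 2) (n ∸ 1) j
  else if inR (t + 2) (n ∸ 1) k then (j ≡ᵇ 2) ∨ (j ≡ᵇ 3) ∨ inR 5 (k ∸ h + 2) j ∨ inR (k + 1) n j
  else if k ≡ᵇ n then (j ≡ᵇ 3) ∨ inR 5 (h + 2) j ∨ (j ≡ᵇ t + 1)
  else if k ≡ᵇ n + 1 then inR (t + 2) n j
  else if k ≡ᵇ n + 2 then (j ≡ᵇ 1) ∨ inR 5 (q + 2) j
  else false
  where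
  n h q t : ℕ
  n = nn x
  h = 2 * x + 2
  q = x + 1
  t = 3 * x + 3

toSide : Bool → Data.Fin.Subset.Side
toSide true  = inside
toSide false = outside

S : (x : ℕ) → Fin (nn x + 3) → Subset (nn x)
S x k = tabulate (λ j → toSide (memb x (toℕ k) (suc (toℕ j))))

unionOf : (x : ℕ) → Subset (nn x + 3) → Subset (nn x)
unionOf x T = ⋃ (map (S x) (filter (_∈? T) (allFin (nn x + 3))))

InCl : (x : ℕ) → Subset (nn x) → Set
InCl x A = ∃ λ (T : Subset (nn x + 3)) → A ≡ unionOf x T

{-# OPTIONS --safe #-}
module Submission where

open import Defs
open import Data.Nat using (ℕ; _*_; _≤_; _^_; NonZero)
open import Data.List using (List; length)
open import Data.List.Relation.Unary.Unique.Propositional using (Unique)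
open import Data.List.Membership.Propositional using (_∈_)
open import Data.Fin.Subset using (Subset)
open import Data.Product using (Σ; ∃; _×_)
open import Function.Bundles using (_⇔_)

open import Data.Bool using (Bool; true; false; T; if_then_else_; _∨_)
open import Data.Bool.Properties using (T-∧; T-∨; T-≡; T?; ∨-assoc) renaming (_≟_ to _≟ᴮ_)
open import Data.Empty using (⊥-elim)
open import Data.Fin using (Fin; zero; suc; toℕ; fromℕ<; #_; remQuot; combine)
open import Data.Fin.Properties
  using (toℕ<n; toℕ-fromℕ<; toℕ-injective; injective⇒≤; any?; combine-remQuot)
open import Data.Fin.Subset using (Side; inside; ⋃; ⁅_⁆; _∪_) renaming (_∈_ to _∈ₛ_)
open import Data.Fin.Subset.Properties
  using (_∈?_; ∉⊥; x∈p∪q⁺; x∈p∪q⁻; x∈⁅x⁆; x∈⁅y⁆⇒x≡y; ⊆-antisym)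
open import Data.List
  using ([]; _∷_; map; filter; upTo; allFin; lookup; _++_; cartesianProduct; cartesianProductWith; deduplicate)
open import Data.List.Properties using (length-map; length-++; length-upTo)
open import Data.List.Membership.Propositional using (find; lose)
open import Data.List.Membership.Propositional.Properties
  using (∈-lookup; ∈-map⁺; ∈-map⁻; ∈-filter⁺; ∈-filter⁻; ∈-allFin; ∈-upTo⁺; ∈-++⁺ˡ; ∈-++⁺ʳ;
         ∈-cartesianProduct⁺; ∈-cartesianProductWith⁺; ∈-deduplicate⁺; ∈-deduplicate⁻)
open import Data.List.Relation.Unary.All as All using ()
open import Data.List.Relation.Unary.AllPairs using (_∷_)
open import Data.List.Relation.Unary.Any using (Any; here; there; index)
import Data.List.Relation.Unary.Any.Properties as Any
import Data.List.Relation.Unary.Unique.DecPropositional.Properties as UniqueDec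
open import Data.Nat
  using (zero; suc; _+_; _∸_; _<_; _≤ᵇ_; _≡ᵇ_; _≟_; _≤?_; _<?_; s≤s; z≤n; z<s; s<s)
open import Data.Nat.Properties
open import Data.Nat.Tactic.RingSolver using (solve-∀)
open import Data.Product using (_,_; proj₁; proj₂; uncurry)
open import Data.Product.Function.NonDependent.Propositional using (_×-⇔_)
open import Data.Sum as Sum using (_⊎_; inj₁; inj₂)
open import Data.Sum.Function.Propositional using (_⊎-⇔_)
open import Data.Vec as Vec using (_∷_; []; tabulate)
open import Data.Vec.Properties using (lookup∘tabulate; []=⇒lookup; lookup⇒[]=; ≡-dec)
open import Function using (_∘_)
open import Function.Bundles using (mk⇔; Equivalence)
open import Function.Construct.Identity using (⇔-id)
open import Function.Definitions using (Injective)
open import Function.Properties.Equivalence using () renaming (sym to ⇔-sym; trans to ⇔-trans)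
open import Level using (0ℓ)
open import Relation.Binary.Definitions using (DecidableEquality)
open import Relation.Binary.PropositionalEquality
open import Relation.Nullary using (¬_; Dec; yes; no; contradiction)
open import Relation.Nullary.Decidable using (⌊_⌋; toWitness; fromWitness; _×-dec_; _⊎-dec_)
open import Relation.Unary using (Pred; Decidable)

open Equivalence using (to; from)

-- Apart from twelve special indices, every index k is of kind A (5 ≤ k ≤ n/2), with
-- S_k = {1,4} ∪ (k, aEnd k], or of kind B (n/2+4 ≤ k ≤ n−1, k ≠ 3n/4+1), with
-- S_k = {2,3} ∪ [5, bEnd k] ∪ (k, n], where aEnd and bEnd are non-decreasing.  So the
-- chosen A-sets, with least and greatest index a ≤ b, have union {1,4} ∪ (a, aEnd b],
-- and the chosen B-sets, with least and greatest index c ≤ d, have union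
-- {2,3} ∪ [5, bEnd d] ∪ (c, n].  On [5, n] the union of these two is again an interval
-- or the complement of one: [5, bEnd d] ∪ (a, n] if c ≤ aEnd b, and [5, aEnd b] ∪ (c, n]
-- otherwise, because then a ≤ bEnd d.  Hence a member of cl(S) is determined by the set
-- of chosen special indices, two bits and a shape given by two numbers below n + 3,
-- which gives |cl(S)| ≤ 2^17 n².  Conversely, for 0 ≤ i, j ≤ x − 2 the unions
-- S_{5+i} ∪ S_{x+4+j} = {1,4} ∪ (5 + i, 3x + 3 + j] are pairwise distinct, which gives
-- |cl(S)| ≥ (x − 1)² ≥ n²/144.

if-true : ∀ {A : Set} {b} {u v : A} → T b → (if b then u else v) ≡ u
if-true {b = true} _ = refl

if-false : ∀ {A : Set} {b} {u v : A} → ¬ T b → (if b then u else v) ≡ v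
if-false {b = true}  ¬b = contradiction _ ¬b
if-false {b = false} _  = refl

T-≡ᵇ : ∀ {m n} → T (m ≡ᵇ n) ⇔ m ≡ n
T-≡ᵇ {m} {n} = mk⇔ (≡ᵇ⇒≡ m n) (≡⇒≡ᵇ m n)

≢⇒¬≡ᵇ : ∀ {m n} → m ≢ n → ¬ T (m ≡ᵇ n)
≢⇒¬≡ᵇ m≢n = m≢n ∘ to T-≡ᵇ

T-inR : ∀ {a b e} → T (inR a b e) ⇔ (a ≤ e × e ≤ b)
T-inR {a} {b} {e} = mk⇔
  (λ p → let (a≤e , e≤b) = to T-∧ p in ≤ᵇ⇒≤ a e a≤e , ≤ᵇ⇒≤ e b e≤b)
  (λ (a≤e , e≤b) → from T-∧ (≤⇒≤ᵇ a≤e , ≤⇒≤ᵇ e≤b))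

inR-above : ∀ {a b e} → b < e → ¬ T (inR a b e)
inR-above {a} b<e = <⇒≱ b<e ∘ proj₂ ∘ to (T-inR {a})

toSide-inside : ∀ b → toSide b ≡ inside ⇔ T b
toSide-inside true  = mk⇔ _ (λ _ → refl)
toSide-inside false = mk⇔ (λ ()) (λ ())

≡⇒⇔ : ∀ {A B : Set} → A ≡ B → A ⇔ B
≡⇒⇔ refl = ⇔-id _

⊎-dropˡ : ∀ {A B : Set} → ¬ A → (A ⊎ B) ⇔ B
⊎-dropˡ ¬a = mk⇔ (λ { (inj₁ a) → contradiction a ¬a ; (inj₂ b) → b }) inj₂

⊎-dropʳ : ∀ {A B : Set} → ¬ B → (A ⊎ B) ⇔ A
⊎-dropʳ ¬b = mk⇔ (λ { (inj₁ a) → a ; (inj₂ b) → contradiction b ¬b }) inj₁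

×-dropˡ : ∀ {A B : Set} → A → (A × B) ⇔ B
×-dropˡ a = mk⇔ proj₂ (a ,_)

×-dropʳ : ∀ {A B : Set} → B → (A × B) ⇔ A
×-dropʳ b = mk⇔ proj₁ (_, b)

∃×-cong : ∀ {P Q R : ℕ → Set} → (∀ {k} → P k → Q k ⇔ R k) →
          (∃ λ k → P k × Q k) ⇔ (∃ λ k → P k × R k)
∃×-cong Q⇔R = mk⇔ (λ (k , pk , qk) → k , pk , to (Q⇔R pk) qk)
                  (λ (k , pk , rk) → k , pk , from (Q⇔R pk) rk)

∃×-const : ∀ {P Q : ℕ → Set} {R : Set} → (∀ {k} → P k → Q k ⇔ R) →
           (∃ λ k → P k × Q k) ⇔ (∃ P × R)
∃×-const Q⇔R = mk⇔ (λ (k , pk , qk) → (k , pk) , to (Q⇔R pk) qk)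
                   (λ ((k , pk) , r) → k , pk , from (Q⇔R pk) r)

∈-tabulate : ∀ {m} {f : Fin m → Side} {i} → i ∈ₛ tabulate f ⇔ f i ≡ inside
∈-tabulate {f = f} {i} = mk⇔
  (λ p → trans (sym (lookup∘tabulate f i)) ([]=⇒lookup p))
  (λ p → lookup⇒[]= i _ (trans (lookup∘tabulate f i) p))

∈-tabulate-dec : ∀ {m} {P : Pred (Fin m) 0ℓ} (P? : Decidable P) {i} →
                 i ∈ₛ tabulate (⌊_⌋ ∘ P?) ⇔ P i
∈-tabulate-dec P? =
  mk⇔ (toWitness ∘ from T-≡ ∘ to ∈-tabulate) (from ∈-tabulate ∘ to T-≡ ∘ fromWitness)

∈-⋃ : ∀ {m} {i : Fin m} ps → i ∈ₛ ⋃ ps ⇔ Any (i ∈ₛ_) ps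
∈-⋃ ps = mk⇔ (∈-⋃⁻ ps) (∈-⋃⁺ ps)
  where
  ∈-⋃⁻ : ∀ {m} {i : Fin m} ps → i ∈ₛ ⋃ ps → Any (i ∈ₛ_) ps
  ∈-⋃⁻ []       i∈ = contradiction i∈ ∉⊥
  ∈-⋃⁻ (p ∷ ps) i∈ with x∈p∪q⁻ p (⋃ ps) i∈
  ... | inj₁ i∈p  = here i∈p
  ... | inj₂ i∈ps = there (∈-⋃⁻ ps i∈ps)
  ∈-⋃⁺ : ∀ {m} {i : Fin m} ps → Any (i ∈ₛ_) ps → i ∈ₛ ⋃ ps
  ∈-⋃⁺ (p ∷ ps) (here i∈p)   = x∈p∪q⁺ (inj₁ i∈p)
  ∈-⋃⁺ (p ∷ ps) (there i∈ps) = x∈p∪q⁺ (inj₂ (∈-⋃⁺ ps i∈ps))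

infix 4 _∈ᴺ_
_∈ᴺ_ : ∀ {m} → ℕ → Subset m → Set
k ∈ᴺ p = ∃ λ i → toℕ i ≡ k × i ∈ₛ p

_∈ᴺ?_ : ∀ {m} k (p : Subset m) → Dec (k ∈ᴺ p)
k ∈ᴺ? p = any? λ i → (toℕ i ≟ k) ×-dec (i ∈? p)

∈ᴺ⇒< : ∀ {m k} {p : Subset m} → k ∈ᴺ p → k < m
∈ᴺ⇒< (i , refl , _) = toℕ<n i

∈ᴺ-pair : ∀ {m a b} (a<m : a < m) (b<m : b < m) {k} →
          k ∈ᴺ (⁅ fromℕ< a<m ⁆ ∪ ⁅ fromℕ< b<m ⁆) ⇔ (k ≡ a ⊎ k ≡ b)
∈ᴺ-pair a<m b<m = mk⇔
  (λ { (i , refl , i∈) → Sum.map (λ i∈a → trans (cong toℕ (x∈⁅y⁆⇒x≡y _ i∈a)) (toℕ-fromℕ< a<m))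
                                  (λ i∈b → trans (cong toℕ (x∈⁅y⁆⇒x≡y _ i∈b)) (toℕ-fromℕ< b<m))
                                  (x∈p∪q⁻ _ _ i∈) })
  (λ { (inj₁ refl) → fromℕ< a<m , toℕ-fromℕ< a<m , x∈p∪q⁺ (inj₁ (x∈⁅x⁆ _))
     ; (inj₂ refl) → fromℕ< b<m , toℕ-fromℕ< b<m , x∈p∪q⁺ (inj₂ (x∈⁅x⁆ _)) })

∀-positions : ∀ {m} {Q : ℕ → Set} → (∀ (i : Fin m) → Q (suc (toℕ i))) →
              ∀ {e} → 1 ≤ e → e ≤ m → Q e
∀-positions {Q = Q} Q-all {suc _} _ e≤m = subst (Q ∘ suc) (toℕ-fromℕ< e≤m) (Q-all (fromℕ< e≤m))

-- Counting

module _ {A : Set} where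

  injection⇒≤length : ∀ {m} {xs : List A} (g : Fin m → A) → Injective _≡_ _≡_ g →
                      (∀ i → g i ∈ xs) → m ≤ length xs
  injection⇒≤length {xs = xs} g g-inj g∈xs = injective⇒≤ λ {i} {j} eq → g-inj (begin
    g i                          ≡⟨ Any.lookup-index (g∈xs i) ⟩
    lookup xs (index (g∈xs i))   ≡⟨ cong (lookup xs) eq ⟩
    lookup xs (index (g∈xs j))   ≡⟨ Any.lookup-index (g∈xs j) ⟨
    g j                          ∎)
    where open ≡-Reasoning

  lookup-injective : ∀ {xs : List A} → Unique xs → Injective _≡_ _≡_ (lookup xs)
  lookup-injective {_ ∷ _}  _          {zero}  {zero}  _  = refl
  lookup-injective {_ ∷ xs} (x∉ ∷ _)   {zero}  {suc j} eq =
    contradiction eq (All.lookup x∉ (∈-lookup {xs = xs} j))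
  lookup-injective {_ ∷ xs} (x∉ ∷ _)   {suc i} {zero}  eq =
    contradiction (sym eq) (All.lookup x∉ (∈-lookup {xs = xs} i))
  lookup-injective {_ ∷ _}  (_ ∷ uniq) {suc i} {suc j} eq = cong suc (lookup-injective uniq eq)

  unique⊆⇒≤length : ∀ {xs ys : List A} → Unique xs → (∀ {a} → a ∈ xs → a ∈ ys) →
                    length xs ≤ length ys
  unique⊆⇒≤length {xs} uniq xs⊆ys =
    injection⇒≤length (lookup xs) (lookup-injective uniq) (xs⊆ys ∘ ∈-lookup)

length-cartesianProductWith : ∀ {A B C : Set} (f : A → B → C) xs ys →
  length (cartesianProductWith f xs ys) ≡ length xs * length ys
length-cartesianProductWith f []       ys = refl
length-cartesianProductWith f (x ∷ xs) ys = begin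
  length (map (f x) ys ++ cartesianProductWith f xs ys)
    ≡⟨ length-++ (map (f x) ys) ⟩
  length (map (f x) ys) + length (cartesianProductWith f xs ys)
    ≡⟨ cong₂ _+_ (length-map (f x) ys) (length-cartesianProductWith f xs ys) ⟩
  length ys + length xs * length ys ∎
  where open ≡-Reasoning

bools : List Bool
bools = true ∷ false ∷ []

∈-bools : ∀ b → b ∈ bools
∈-bools true  = here refl
∈-bools false = there (here refl)

opaque
  allSubsets : ∀ m → List (Subset m)
  allSubsets zero    = [] ∷ []
  allSubsets (suc m) = cartesianProductWith _∷_ bools (allSubsets m)

  ∈-allSubsets : ∀ {m} (p : Subset m) → p ∈ allSubsets m
  ∈-allSubsets []      = here refl
  ∈-allSubsets (s ∷ p) = ∈-cartesianProductWith⁺ _∷_ (∈-bools s) (∈-allSubsets p)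

  length-allSubsets : ∀ m → length (allSubsets m) ≡ 2 ^ m
  length-allSubsets zero    = refl
  length-allSubsets (suc m) = trans (length-cartesianProductWith _∷_ bools (allSubsets m))
                                    (cong (2 *_) (length-allSubsets m))

≤-by : ∀ {m n} d → m + d ≡ n → m ≤ n
≤-by {m} d refl = m≤m+n m d

one-of-three : ∀ {m k} → m ≤ k → k ≤ 2 + m → k ≡ m ⊎ k ≡ 1 + m ⊎ k ≡ 2 + m
one-of-three {zero}  {0}       _   _ = inj₁ refl
one-of-three {zero}  {1}       _   _ = inj₂ (inj₁ refl)
one-of-three {zero}  {2}       _   _ = inj₂ (inj₂ refl)
one-of-three {zero}  {suc (suc (suc _))} _ (s≤s (s≤s ()))
one-of-three {suc m} {suc k} (s≤s m≤k) (s≤s k≤2+m) =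
  Sum.map (cong suc) (Sum.map (cong suc) (cong suc)) (one-of-three m≤k k≤2+m)

m+[n∸m+d]≡d+n : ∀ {m n} d → m ≤ n → m + (n ∸ m + d) ≡ d + n
m+[n∸m+d]≡d+n {m} {n} d m≤n = begin
  m + (n ∸ m + d)  ≡⟨ +-assoc m (n ∸ m) d ⟨
  m + (n ∸ m) + d  ≡⟨ cong (_+ d) (m+[n∸m]≡n m≤n) ⟩
  n + d            ≡⟨ +-comm n d ⟩
  d + n            ∎
  where open ≡-Reasoning

-- Least and greatest elements

record MinMax (P : ℕ → Set) (lo hi : ℕ) : Set where
  field
    P-lo    : P lo
    P-hi    : P hi
    between : ∀ {k} → P k → lo ≤ k × k ≤ hi

data Extremes (P : ℕ → Set) : Set where
  none  : (∀ {k} → ¬ P k) → Extremes P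
  range : ∀ {lo hi} → MinMax P lo hi → Extremes P

nonempty : ∀ {P} → Extremes P → Bool
nonempty (none _)  = false
nonempty (range _) = true

T-nonempty : ∀ {P} (E : Extremes P) → T (nonempty E) ⇔ ∃ P
T-nonempty (none ∅)   = mk⇔ (λ ()) (λ (_ , p) → ∅ p)
T-nonempty (range mm) = mk⇔ (λ _ → _ , MinMax.P-lo mm) (λ _ → _)

extremes-below : ∀ {P : ℕ → Set} → Decidable P → ∀ N → Extremes (λ k → k < N × P k)
extremes-below P? zero = none (λ ())
extremes-below {P} P? (suc N) with extremes-below P? N | P? N
... | none ∅ | no ¬pN = none λ (k<1+N , pk) → case (m<1+n⇒m<n∨m≡n k<1+N) pk
  where
  case : ∀ {k} → k < N ⊎ k ≡ N → ¬ P k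
  case (inj₁ k<N)  pk = ∅ (k<N , pk)
  case (inj₂ refl) pk = ¬pN pk
... | none ∅ | yes pN = range record
  { P-lo = ≤-refl , pN ; P-hi = ≤-refl , pN
  ; between = λ (k<1+N , pk) → case (m<1+n⇒m<n∨m≡n k<1+N) pk }
  where
  case : ∀ {k} → k < N ⊎ k ≡ N → P k → N ≤ k × k ≤ N
  case (inj₁ k<N)  pk = ⊥-elim (∅ (k<N , pk))
  case (inj₂ refl) pk = ≤-refl , ≤-refl
... | range {lo} {hi} mm | no ¬pN = range record
  { P-lo = m<n⇒m<1+n (proj₁ P-lo) , proj₂ P-lo ; P-hi = m<n⇒m<1+n (proj₁ P-hi) , proj₂ P-hi
  ; between = λ (k<1+N , pk) → case (m<1+n⇒m<n∨m≡n k<1+N) pk }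
  where
  open MinMax mm
  case : ∀ {k} → k < N ⊎ k ≡ N → P k → lo ≤ k × k ≤ hi
  case (inj₁ k<N)  pk = between (k<N , pk)
  case (inj₂ refl) pk = contradiction pk ¬pN
... | range {lo} {hi} mm | yes pN = range record
  { P-lo = m<n⇒m<1+n (proj₁ P-lo) , proj₂ P-lo ; P-hi = ≤-refl , pN
  ; between = λ (k<1+N , pk) → case (m<1+n⇒m<n∨m≡n k<1+N) pk }
  where
  open MinMax mm
  case : ∀ {k} → k < N ⊎ k ≡ N → P k → lo ≤ k × k ≤ N
  case (inj₁ k<N)  pk = proj₁ (between (k<N , pk)) , <⇒≤ k<N
  case (inj₂ refl) pk = <⇒≤ (proj₁ P-lo) , ≤-refl

extremes : ∀ {P : ℕ → Set} → Decidable P → ∀ {N} → (∀ {k} → P k → k < N) → Extremes P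
extremes P? {N} bounded with extremes-below P? N
... | none ∅   = none (λ pk → ∅ (bounded pk , pk))
... | range mm = range record
  { P-lo = proj₂ P-lo ; P-hi = proj₂ P-hi ; between = λ pk → between (bounded pk , pk) }
  where open MinMax mm

-- Intervals

data Shape : Set where
  interval cointerval : ℕ → ℕ → Shape

infix 4 _∈ˢ_
_∈ˢ_ : ℕ → Shape → Set
e ∈ˢ interval   p r = p < e × e ≤ r
e ∈ˢ cointerval p r = e ≤ p ⊎ r < e

_∈ˢ?_ : ∀ e s → Dec (e ∈ˢ s)
e ∈ˢ? interval   p r = (p <? e) ×-dec (e ≤? r)
e ∈ˢ? cointerval p r = (e ≤? p) ⊎-dec (r <? e)

∉-empty : ∀ {e} → ¬ e ∈ˢ interval 0 0
∉-empty (0<e , e≤0) = <⇒≱ 0<e e≤0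

T-inR-interval : ∀ {p r e} → T (inR (p + 1) r e) ⇔ e ∈ˢ interval p r
T-inR-interval {p} {r} {e} = ⇔-trans T-inR
  (mk⇔ (λ (p+1≤e , e≤r) → subst (_≤ e) (+-comm p 1) p+1≤e , e≤r)
       (λ (p<e , e≤r) → subst (_≤ e) (+-comm 1 p) p<e , e≤r))

opaque
  shapes : ℕ → List Shape
  shapes N = map (uncurry interval) (cartesianProduct (upTo N) (upTo N))
          ++ map (uncurry cointerval) (cartesianProduct (upTo N) (upTo N))

  interval∈shapes : ∀ {N p r} → p < N → r < N → interval p r ∈ shapes N
  interval∈shapes p<N r<N =
    ∈-++⁺ˡ (∈-map⁺ (uncurry interval) (∈-cartesianProduct⁺ (∈-upTo⁺ p<N) (∈-upTo⁺ r<N)))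

  cointerval∈shapes : ∀ {N p r} → p < N → r < N → cointerval p r ∈ shapes N
  cointerval∈shapes {N} p<N r<N = ∈-++⁺ʳ (map (uncurry interval) (cartesianProduct (upTo N) (upTo N)))
    (∈-map⁺ (uncurry cointerval) (∈-cartesianProduct⁺ (∈-upTo⁺ p<N) (∈-upTo⁺ r<N)))

  length-shapes : ∀ N → length (shapes N) ≡ N * N + N * N
  length-shapes N = begin
    length (map (uncurry interval) pairs ++ map (uncurry cointerval) pairs)
      ≡⟨ length-++ (map (uncurry interval) pairs) ⟩
    length (map (uncurry interval) pairs) + length (map (uncurry cointerval) pairs)
      ≡⟨ cong₂ _+_ (length-map (uncurry interval) pairs) (length-map (uncurry cointerval) pairs) ⟩
    length pairs + length pairs
      ≡⟨ cong (λ l → l + l) (length-cartesianProductWith _,_ (upTo N) (upTo N)) ⟩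
    length (upTo N) * length (upTo N) + length (upTo N) * length (upTo N)
      ≡⟨ cong (λ l → l * l + l * l) (length-upTo N) ⟩
    N * N + N * N ∎
    where
    open ≡-Reasoning
    pairs : List (ℕ × ℕ)
    pairs = cartesianProduct (upTo N) (upTo N)

module _ {P : ℕ → Set} {lo hi : ℕ} (mm : MinMax P lo hi) where
  open MinMax mm

  ⋃-intervals : ∀ {f : ℕ → ℕ} → (∀ {k} → P k → f k ≤ f hi) → hi ≤ f lo →
                ∀ {e} → (∃ λ k → P k × e ∈ˢ interval k (f k)) ⇔ e ∈ˢ interval lo (f hi)
  ⋃-intervals {f} f-mono hi≤f[lo] {e} = mk⇔
    (λ (k , pk , k<e , e≤f[k]) → ≤-<-trans (proj₁ (between pk)) k<e , ≤-trans e≤f[k] (f-mono pk))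
    from′
    where
    from′ : e ∈ˢ interval lo (f hi) → ∃ λ k → P k × e ∈ˢ interval k (f k)
    from′ (lo<e , e≤f[hi]) with e ≤? hi
    ... | yes e≤hi = lo , P-lo , lo<e , ≤-trans e≤hi hi≤f[lo]
    ... | no  e≰hi = hi , P-hi , ≰⇒> e≰hi , e≤f[hi]

  ⋃-cointervals : ∀ {g : ℕ → ℕ} → (∀ {k} → P k → g k ≤ g hi) →
                  ∀ {e} → (∃ λ k → P k × e ∈ˢ cointerval (g k) k) ⇔ e ∈ˢ cointerval (g hi) lo
  ⋃-cointervals g-mono = mk⇔
    (λ { (k , pk , inj₁ e≤g[k]) → inj₁ (≤-trans e≤g[k] (g-mono pk))
       ; (k , pk , inj₂ k<e)    → inj₂ (≤-<-trans (proj₁ (between pk)) k<e) })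
    (λ { (inj₁ e≤g[hi]) → hi , P-hi , inj₁ e≤g[hi]
       ; (inj₂ lo<e)    → lo , P-lo , inj₂ lo<e })

merge-overlapping : ∀ {a l r c e} → a < c → c ≤ l →
  (e ∈ˢ interval a l ⊎ e ∈ˢ cointerval r c) ⇔ e ∈ˢ cointerval r a
merge-overlapping {a} {l} {r} {c} {e} a<c c≤l = mk⇔
  (λ { (inj₁ (a<e , _))  → inj₂ a<e
     ; (inj₂ (inj₁ e≤r)) → inj₁ e≤r
     ; (inj₂ (inj₂ c<e)) → inj₂ (<-trans a<c c<e) })
  from′
  where
  from′ : e ∈ˢ cointerval r a → e ∈ˢ interval a l ⊎ e ∈ˢ cointerval r c
  from′ (inj₁ e≤r) = inj₂ (inj₁ e≤r)
  from′ (inj₂ a<e) with e ≤? l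
  ... | yes e≤l = inj₁ (a<e , e≤l)
  ... | no  e≰l = inj₂ (inj₂ (≤-<-trans c≤l (≰⇒> e≰l)))

merge-separated : ∀ {a l r c e} → a ≤ r → r ≤ l →
  (e ∈ˢ interval a l ⊎ e ∈ˢ cointerval r c) ⇔ e ∈ˢ cointerval l c
merge-separated {a} {l} {r} {c} {e} a≤r r≤l = mk⇔
  (λ { (inj₁ (_ , e≤l))  → inj₁ e≤l
     ; (inj₂ (inj₁ e≤r)) → inj₁ (≤-trans e≤r r≤l)
     ; (inj₂ (inj₂ c<e)) → inj₂ c<e })
  from′
  where
  from′ : e ∈ˢ cointerval l c → e ∈ˢ interval a l ⊎ e ∈ˢ cointerval r c
  from′ (inj₂ c<e) = inj₂ (inj₂ c<e)
  from′ (inj₁ e≤l) with e ≤? r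
  ... | yes e≤r = inj₂ (inj₁ e≤r)
  ... | no  e≰r = inj₁ (≤-<-trans a≤r (≰⇒> e≰r) , e≤l)

interval-endpoints : ∀ {L U p r p′ r′} → L ≤ p → p < r → r ≤ U → L ≤ p′ → p′ < r′ → r′ ≤ U →
  (∀ {e} → L ≤ e → e ≤ U → e ∈ˢ interval p r ⇔ e ∈ˢ interval p′ r′) → p ≡ p′ × r ≡ r′
interval-endpoints L≤p p<r r≤U L≤p′ p′<r′ r′≤U same =
  let (p′≤p , r≤r′) = shrink L≤p p<r r≤U same
      (p≤p′ , r′≤r) = shrink L≤p′ p′<r′ r′≤U (λ L≤e e≤U → ⇔-sym (same L≤e e≤U))
  in ≤-antisym p≤p′ p′≤p , ≤-antisym r≤r′ r′≤r
  where
  shrink : ∀ {L U p r p′ r′} → L ≤ p → p < r → r ≤ U →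
    (∀ {e} → L ≤ e → e ≤ U → e ∈ˢ interval p r ⇔ e ∈ˢ interval p′ r′) → p′ ≤ p × r ≤ r′
  shrink L≤p p<r r≤U same =
    ≤-pred (proj₁ (to (same (m≤n⇒m≤1+n L≤p) (≤-trans p<r r≤U)) (≤-refl , p<r))) ,
    proj₂ (to (same (≤-trans L≤p (<⇒≤ p<r)) r≤U) (p<r , ≤-refl))

-- The family S^(x)

-- Writing x = 2 + y turns the comparisons between n/4, n/2, 3n/4 and n into ring
-- identities in y.
module Family (y : ℕ) where

  x n h q t N : ℕ
  x = 2 + y
  n = nn x
  h = 2 * x + 2
  q = x + 1
  t = 3 * x + 3
  N = n + 3

  q+2<h+4 : q + 2 < h + 4
  q+2<h+4 = ≤-by (y + 4) (e y)
    where e : ∀ y → suc (2 + y + 1 + 2) + (y + 4) ≡ 2 * (2 + y) + 2 + 4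
          e = solve-∀

  h+4≤t+2 : h + 4 ≤ t + 2
  h+4≤t+2 = ≤-by (1 + y) (e y)
    where e : ∀ y → 2 * (2 + y) + 2 + 4 + (1 + y) ≡ 3 * (2 + y) + 3 + 2
          e = solve-∀

  t<n : t < n
  t<n = ≤-by (2 + y) (e y)
    where e : ∀ y → suc (3 * (2 + y) + 3) + (2 + y) ≡ 4 * (2 + y) + 4
          e = solve-∀

  h<n : h < n
  h<n = ≤-by (2 * y + 5) (e y)
    where e : ∀ y → suc (2 * (2 + y) + 2) + (2 * y + 5) ≡ 4 * (2 + y) + 4
          e = solve-∀

  n<N : n < N
  n<N = m<m+n n z<s

  5≤h : 5 ≤ h
  5≤h = ≤-by (2 * y + 1) (e y)
    where e : ∀ y → 5 + (2 * y + 1) ≡ 2 * (2 + y) + 2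
          e = solve-∀

  n≡h+h : n ≡ h + h
  n≡h+h = e y
    where e : ∀ y → 4 * (2 + y) + 4 ≡ 2 * (2 + y) + 2 + (2 * (2 + y) + 2)
          e = solve-∀

  q+2<k⇒3+t≤h+k : ∀ {k} → q + 2 < k → 3 + t ≤ h + k
  q+2<k⇒3+t≤h+k q+2<k = ≤-trans (≤-reflexive (e y)) (+-monoʳ-≤ h q+2<k)
    where e : ∀ y → 3 + (3 * (2 + y) + 3) ≡ 2 * (2 + y) + 2 + suc (2 + y + 1 + 2)
          e = solve-∀

  InS : ℕ → ℕ → Set
  InS k e = T (memb x k e)

  -- Apart from the special indices below, S_k = {1,4} ∪ (k, aEnd k] when IsA k and
  -- S_k = {2,3} ∪ [5, bEnd k] ∪ (k, n] when IsB k.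
  aEnd bEnd : ℕ → ℕ
  aEnd k = if k ≤ᵇ q + 2 then h + k ∸ 2 else h + k ∸ 3
  bEnd k = if k ≤ᵇ t then k ∸ h + 1 else k ∸ h + 2

  IsA IsB : ℕ → Set
  IsA k = 5 ≤ k × k ≤ h
  IsB k = (h + 4 ≤ k × k ≤ t) ⊎ (t + 2 ≤ k × k < n)

  IsA? : ∀ k → Dec (IsA k)
  IsA? k = (5 ≤? k) ×-dec (k ≤? h)

  IsB? : ∀ k → Dec (IsB k)
  IsB? k = ((h + 4 ≤? k) ×-dec (k ≤? t)) ⊎-dec ((t + 2 ≤? k) ×-dec (k <? n))

  IsA⇒<N : ∀ {k} → IsA k → k < N
  IsA⇒<N (_ , k≤h) = ≤-<-trans k≤h (<-trans h<n n<N)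

  IsB⇒h+4≤ : ∀ {k} → IsB k → h + 4 ≤ k
  IsB⇒h+4≤ (inj₁ (h+4≤k , _)) = h+4≤k
  IsB⇒h+4≤ (inj₂ (t+2≤k , _)) = ≤-trans h+4≤t+2 t+2≤k

  IsB⇒h≤ : ∀ {k} → IsB k → h ≤ k
  IsB⇒h≤ kB = ≤-trans (m≤m+n h 4) (IsB⇒h+4≤ kB)

  IsB⇒5≤ : ∀ {k} → IsB k → 5 ≤ k
  IsB⇒5≤ kB = ≤-trans 5≤h (IsB⇒h≤ kB)

  IsB⇒<n : ∀ {k} → IsB k → k < n
  IsB⇒<n (inj₁ (_ , k≤t)) = ≤-<-trans k≤t t<n
  IsB⇒<n (inj₂ (_ , k<n)) = k<n

  IsA<IsB : ∀ {a c} → IsA a → IsB c → a < c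
  IsA<IsB (_ , a≤h) cB = ≤-<-trans a≤h (<-≤-trans (m<m+n h z<s) (IsB⇒h+4≤ cB))

  aEnd-≤ : ∀ {k} → k ≤ q + 2 → aEnd k ≡ h + k ∸ 2
  aEnd-≤ = if-true ∘ ≤⇒≤ᵇ

  aEnd-> : ∀ {k} → q + 2 < k → aEnd k ≡ h + k ∸ 3
  aEnd-> q+2<k = if-false (<⇒≱ q+2<k ∘ ≤ᵇ⇒≤ _ _)

  bEnd-≤ : ∀ {k} → k ≤ t → bEnd k ≡ k ∸ h + 1
  bEnd-≤ = if-true ∘ ≤⇒≤ᵇ

  bEnd-> : ∀ {k} → t < k → bEnd k ≡ k ∸ h + 2
  bEnd-> t<k = if-false (<⇒≱ t<k ∘ ≤ᵇ⇒≤ _ _)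

  k≢ᵇh+i : ∀ {k} → h + 4 ≤ k → ∀ i → i < 4 → ¬ T (k ≡ᵇ h + i)
  k≢ᵇh+i h+4≤k i i<4 = ≢⇒¬≡ᵇ (>⇒≢ (<-≤-trans (+-monoʳ-< h i<4) h+4≤k))

  -- Writing k = 5 + k′ lets memb's first five tests k ≡ᵇ 0, …, k ≡ᵇ 4 compute to false.
  memb-A : ∀ {k e} → IsA k → memb x k e ≡ ((e ≡ᵇ 1) ∨ (e ≡ᵇ 4) ∨ inR (k + 1) (aEnd k) e)
  memb-A {k} {e} (5≤k , k≤h) with m≤n⇒∃[o]m+o≡n 5≤k
  ... | k′ , refl with 5 + k′ ≤? q + 2
  ... | yes k≤q+2 rewrite aEnd-≤ k≤q+2 = if-true (≤⇒≤ᵇ k≤q+2)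
  ... | no k≰q+2 rewrite aEnd-> (≰⇒> k≰q+2) =
    trans (if-false (k≰q+2 ∘ ≤ᵇ⇒≤ _ _))
          (if-true (from T-inR (subst (_≤ 5 + k′) (sym (+-suc q 2)) (≰⇒> k≰q+2) , k≤h)))

  memb-B : ∀ {k e} → IsB k →
           memb x k e ≡ ((e ≡ᵇ 2) ∨ (e ≡ᵇ 3) ∨ inR 5 (bEnd k) e ∨ inR (k + 1) n e)
  memb-B {k} {e} kB with m≤n⇒∃[o]m+o≡n (IsB⇒5≤ kB)
  ... | k′ , refl with kB
  ... | inj₁ (h+4≤k , k≤t) rewrite bEnd-≤ k≤t =
    trans (if-false (<⇒≱ (<-≤-trans q+2<h+4 h+4≤k) ∘ ≤ᵇ⇒≤ _ _))
    (trans (if-false (inR-above {q + 3} (<-≤-trans (m<m+n h z<s) h+4≤k)))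
    (trans (if-false (k≢ᵇh+i h+4≤k 1 (s<s z<s)))
    (trans (if-false (k≢ᵇh+i h+4≤k 2 (s<s (s<s z<s))))
    (trans (if-false (k≢ᵇh+i h+4≤k 3 (s<s (s<s (s<s z<s)))))
    (if-true (from T-inR (h+4≤k , k≤t)))))))
  ... | inj₂ (t+2≤k , k<n) rewrite bEnd-> (<-≤-trans (m<m+n t z<s) t+2≤k) =
    trans (if-false (<⇒≱ (<-≤-trans q+2<h+4 h+4≤k) ∘ ≤ᵇ⇒≤ _ _))
    (trans (if-false (inR-above {q + 3} (<-≤-trans (m<m+n h z<s) h+4≤k)))
    (trans (if-false (k≢ᵇh+i h+4≤k 1 (s<s z<s)))
    (trans (if-false (k≢ᵇh+i h+4≤k 2 (s<s (s<s z<s))))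
    (trans (if-false (k≢ᵇh+i h+4≤k 3 (s<s (s<s (s<s z<s)))))
    (trans (if-false (inR-above {h + 4} (<-≤-trans (m<m+n t z<s) t+2≤k)))
    (trans (if-false (≢⇒¬≡ᵇ (>⇒≢ (<-≤-trans (+-monoʳ-< t (s<s z<s)) t+2≤k))))
    (if-true (from T-inR (t+2≤k , ≤-pred k<n)))))))))
    where h+4≤k = ≤-trans h+4≤t+2 t+2≤k

  LowA LowB : ℕ → Set
  LowA e = e ≡ 1 ⊎ e ≡ 4
  LowB e = e ≡ 2 ⊎ e ≡ 3

  LowA⇒<5 : ∀ {e} → LowA e → e < 5
  LowA⇒<5 (inj₁ refl) = s≤s (s≤s z≤n)
  LowA⇒<5 (inj₂ refl) = ≤-refl

  LowB⇒<5 : ∀ {e} → LowB e → e < 5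
  LowB⇒<5 (inj₁ refl) = s≤s (s≤s (s≤s z≤n))
  LowB⇒<5 (inj₂ refl) = s≤s (s≤s (s≤s (s≤s z≤n)))

  T-≡ᵇ-∨ : ∀ {e a b} → T ((e ≡ᵇ a) ∨ (e ≡ᵇ b)) ⇔ (e ≡ a ⊎ e ≡ b)
  T-≡ᵇ-∨ = ⇔-trans T-∨ (T-≡ᵇ ⊎-⇔ T-≡ᵇ)

  InS-A : ∀ {k e} → IsA k → InS k e ⇔ (LowA e ⊎ e ∈ˢ interval k (aEnd k))
  InS-A {k} {e} kA =
    ⇔-trans (≡⇒⇔ (cong T (trans (memb-A {k} {e} kA) (sym (∨-assoc (e ≡ᵇ 1) (e ≡ᵇ 4) _)))))
            (⇔-trans T-∨ (T-≡ᵇ-∨ ⊎-⇔ T-inR-interval))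

  InS-B : ∀ {k e} → IsB k → InS k e ⇔ (LowB e ⊎ (5 ≤ e × e ≤ bEnd k) ⊎ e ∈ˢ interval k n)
  InS-B {k} {e} kB =
    ⇔-trans (≡⇒⇔ (cong T (trans (memb-B {k} {e} kB) (sym (∨-assoc (e ≡ᵇ 2) (e ≡ᵇ 3) _)))))
            (⇔-trans T-∨ (T-≡ᵇ-∨ ⊎-⇔ ⇔-trans T-∨ (T-inR ⊎-⇔ T-inR-interval)))

  InS-A-low : ∀ {k e} → IsA k → e < 5 → InS k e ⇔ LowA e
  InS-A-low kA@(5≤k , _) e<5 =
    ⇔-trans (InS-A kA) (⊎-dropʳ λ (k<e , _) → <⇒≱ e<5 (≤-trans 5≤k (<⇒≤ k<e)))

  InS-A-high : ∀ {k e} → IsA k → 5 ≤ e → InS k e ⇔ e ∈ˢ interval k (aEnd k)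
  InS-A-high kA 5≤e = ⇔-trans (InS-A kA) (⊎-dropˡ λ low → <⇒≱ (LowA⇒<5 low) 5≤e)

  InS-B-low : ∀ {k e} → IsB k → e < 5 → InS k e ⇔ LowB e
  InS-B-low kB e<5 = ⇔-trans (InS-B kB) (⊎-dropʳ λ
    { (inj₁ (5≤e , _)) → <⇒≱ e<5 5≤e
    ; (inj₂ (k<e , _)) → <⇒≱ e<5 (≤-trans (IsB⇒5≤ kB) (<⇒≤ k<e)) })

  InS-B-high : ∀ {k e} → IsB k → 5 ≤ e → e ≤ n → InS k e ⇔ e ∈ˢ cointerval (bEnd k) k
  InS-B-high kB 5≤e e≤n = ⇔-trans (InS-B kB)
    (⇔-trans (⊎-dropˡ λ low → <⇒≱ (LowB⇒<5 low) 5≤e) (×-dropˡ 5≤e ⊎-⇔ ×-dropʳ e≤n))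

  2+aEnd-≤ : ∀ {k} → k ≤ q + 2 → 2 + aEnd k ≡ h + k
  2+aEnd-≤ {k} k≤ rewrite aEnd-≤ k≤ = m+[n∸m]≡n (≤-trans (m≤m+n 2 3) (≤-trans 5≤h (m≤m+n h k)))

  3+aEnd-> : ∀ {k} → q + 2 < k → 3 + aEnd k ≡ h + k
  3+aEnd-> {k} q+2<k rewrite aEnd-> q+2<k = m+[n∸m]≡n (≤-trans (m≤m+n 3 2) (≤-trans 5≤h (m≤m+n h k)))

  aEnd-bounds : ∀ k → 2 + aEnd k ≤ h + k × h + k ≤ 3 + aEnd k
  aEnd-bounds k with k ≤? q + 2
  ... | yes k≤ = ≤-reflexive (2+aEnd-≤ k≤) , ≤-trans (≤-reflexive (sym (2+aEnd-≤ k≤))) (n≤1+n _)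
  ... | no k≰  = ≤-trans (n≤1+n _) (≤-reflexive (3+aEnd-> (≰⇒> k≰))) ,
                 ≤-reflexive (sym (3+aEnd-> (≰⇒> k≰)))

  h+bEnd-≤ : ∀ {k} → h ≤ k → k ≤ t → h + bEnd k ≡ 1 + k
  h+bEnd-≤ h≤k k≤t rewrite bEnd-≤ k≤t = m+[n∸m+d]≡d+n 1 h≤k

  h+bEnd-> : ∀ {k} → h ≤ k → t < k → h + bEnd k ≡ 2 + k
  h+bEnd-> h≤k t<k rewrite bEnd-> t<k = m+[n∸m+d]≡d+n 2 h≤k

  bEnd-bounds : ∀ {k} → h ≤ k → 1 + k ≤ h + bEnd k × h + bEnd k ≤ 2 + k
  bEnd-bounds {k} h≤k with k ≤? t
  ... | yes k≤t = ≤-reflexive (sym (h+bEnd-≤ h≤k k≤t)) ,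
                  ≤-trans (≤-reflexive (h+bEnd-≤ h≤k k≤t)) (n≤1+n _)
  ... | no k≰t  = ≤-trans (n≤1+n _) (≤-reflexive (sym (h+bEnd-> h≤k (≰⇒> k≰t)))) ,
                  ≤-reflexive (h+bEnd-> h≤k (≰⇒> k≰t))

  aEnd-mono : ∀ {k k′} → k ≤ k′ → aEnd k ≤ aEnd k′
  aEnd-mono {k} {k′} k≤k′ with m≤n⇒m<n∨m≡n k≤k′
  ... | inj₂ refl = ≤-refl
  ... | inj₁ k<k′ = +-cancelˡ-≤ 2 _ _ (≤-pred (begin-strict
    2 + aEnd k   ≤⟨ proj₁ (aEnd-bounds k) ⟩
    h + k        <⟨ +-monoʳ-< h k<k′ ⟩
    h + k′       ≤⟨ proj₂ (aEnd-bounds k′) ⟩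
    3 + aEnd k′  ∎))
    where open ≤-Reasoning

  bEnd-mono : ∀ {k k′} → h ≤ k → k ≤ k′ → bEnd k ≤ bEnd k′
  bEnd-mono {k} {k′} h≤k k≤k′ with m≤n⇒m<n∨m≡n k≤k′
  ... | inj₂ refl = ≤-refl
  ... | inj₁ k<k′ = +-cancelˡ-≤ h _ _ (begin
    h + bEnd k   ≤⟨ proj₂ (bEnd-bounds h≤k) ⟩
    2 + k        ≤⟨ s≤s k<k′ ⟩
    1 + k′       ≤⟨ proj₁ (bEnd-bounds (≤-trans h≤k k≤k′)) ⟩
    h + bEnd k′  ∎)
    where open ≤-Reasoning

  2+h≤aEnd : ∀ {k} → IsA k → 2 + h ≤ aEnd k
  2+h≤aEnd {k} (5≤k , _) = +-cancelˡ-≤ 3 _ _ (begin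
    5 + h        ≡⟨ +-comm 5 h ⟩
    h + 5        ≤⟨ +-monoʳ-≤ h 5≤k ⟩
    h + k        ≤⟨ proj₂ (aEnd-bounds k) ⟩
    3 + aEnd k   ∎)
    where open ≤-Reasoning

  aEnd<n : ∀ {k} → IsA k → aEnd k < n
  aEnd<n {k} (_ , k≤h) = begin-strict
    aEnd k       <⟨ n<1+n _ ⟩
    1 + aEnd k   ≤⟨ n≤1+n _ ⟩
    2 + aEnd k   ≤⟨ proj₁ (aEnd-bounds k) ⟩
    h + k        ≤⟨ +-monoʳ-≤ h k≤h ⟩
    h + h        ≡⟨ n≡h+h ⟨
    n            ∎
    where open ≤-Reasoning

  bEnd≤1+h : ∀ {k} → IsB k → bEnd k ≤ 1 + h
  bEnd≤1+h {k} kB = +-cancelˡ-≤ h _ _ (begin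
    h + bEnd k   ≤⟨ proj₂ (bEnd-bounds (IsB⇒h≤ kB)) ⟩
    2 + k        ≤⟨ s≤s (IsB⇒<n kB) ⟩
    1 + n        ≡⟨ cong suc n≡h+h ⟩
    1 + (h + h)  ≡⟨ +-suc h h ⟨
    h + (1 + h)  ∎)
    where open ≤-Reasoning

  IsA⇒≤aEnd : ∀ {a b} → IsA a → IsA b → b ≤ aEnd a
  IsA⇒≤aEnd aA (_ , b≤h) = ≤-trans b≤h (≤-trans (m≤n+m h 2) (2+h≤aEnd aA))

  bEnd<N : ∀ {k} → IsB k → bEnd k < N
  bEnd<N kB = ≤-<-trans (≤-trans (bEnd≤1+h kB) h<n) n<N

  -- The offsets in S_k are tuned for this: if b > n/4 + 2, then aEnd b ≥ 3n/4, so c is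
  -- past 3n/4 + 1 and S_c reaches up to c − n/2 + 2.
  aEnd<⇒≤bEnd : ∀ {b c} → IsA b → IsB c → aEnd b < c → b ≤ bEnd c
  aEnd<⇒≤bEnd {b} {c} bA cB aEnd<c with b ≤? q + 2 | c ≤? t
  ... | yes b≤ | _ = +-cancelˡ-≤ h _ _ (begin
    h + b        ≡⟨ 2+aEnd-≤ b≤ ⟨
    2 + aEnd b   ≤⟨ s≤s aEnd<c ⟩
    1 + c        ≤⟨ proj₁ (bEnd-bounds (IsB⇒h≤ cB)) ⟩
    h + bEnd c   ∎)
    where open ≤-Reasoning
  ... | no b≰ | yes c≤t = contradiction (begin-strict
    3 + t        ≤⟨ q+2<k⇒3+t≤h+k (≰⇒> b≰) ⟩
    h + b        ≡⟨ 3+aEnd-> (≰⇒> b≰) ⟨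
    3 + aEnd b   <⟨ s≤s (s≤s (s≤s (<-≤-trans aEnd<c c≤t))) ⟩
    3 + t        ∎) (<-irrefl refl)
    where open ≤-Reasoning
  ... | no b≰ | no c≰t = +-cancelˡ-≤ h _ _ (begin
    h + b        ≡⟨ 3+aEnd-> (≰⇒> b≰) ⟨
    3 + aEnd b   ≤⟨ s≤s (s≤s aEnd<c) ⟩
    2 + c        ≡⟨ h+bEnd-> (IsB⇒h≤ cB) (≰⇒> c≰t) ⟨
    h + bEnd c   ∎)
    where open ≤-Reasoning

  special : Fin 12 → ℕ
  special = Vec.lookup (0 ∷ 1 ∷ 2 ∷ 3 ∷ 4 ∷ 1 + h ∷ 2 + h ∷ 3 + h ∷ 1 + t ∷ n ∷ 1 + n ∷ 2 + n ∷ [])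

  IsSpecial : ℕ → Set
  IsSpecial k = ∃ λ j → special j ≡ k

  classify : ∀ {k} → k < N → IsSpecial k ⊎ IsA k ⊎ IsB k
  classify {0} _ = inj₁ (# 0 , refl)
  classify {1} _ = inj₁ (# 1 , refl)
  classify {2} _ = inj₁ (# 2 , refl)
  classify {3} _ = inj₁ (# 3 , refl)
  classify {4} _ = inj₁ (# 4 , refl)
  classify {k@(suc (suc (suc (suc (suc _)))))} k<N with k ≤? h
  ... | yes k≤h = inj₂ (inj₁ (s≤s (s≤s (s≤s (s≤s (s≤s z≤n)))) , k≤h))
  ... | no k≰h with k ≤? 3 + h
  ...   | yes k≤3+h = inj₁ (middle (one-of-three (≰⇒> k≰h) k≤3+h))
    where
    middle : k ≡ 1 + h ⊎ k ≡ 2 + h ⊎ k ≡ 3 + h → IsSpecial k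
    middle (inj₁ k≡)        = # 5 , sym k≡
    middle (inj₂ (inj₁ k≡)) = # 6 , sym k≡
    middle (inj₂ (inj₂ k≡)) = # 7 , sym k≡
  ...   | no k≰3+h with k ≤? t
  ...     | yes k≤t = inj₂ (inj₂ (inj₁ (subst (_≤ k) (+-comm 4 h) (≰⇒> k≰3+h) , k≤t)))
  ...     | no k≰t with k ≟ 1 + t
  ...       | yes k≡ = inj₁ (# 8 , sym k≡)
  ...       | no k≢1+t with k <? n
  ...         | yes k<n =
    inj₂ (inj₂ (inj₂ (subst (_≤ k) (+-comm 2 t) (≤∧≢⇒< (≰⇒> k≰t) (k≢1+t ∘ sym)) , k<n)))
  ...         | no k≮n = inj₁ (top (one-of-three (≮⇒≥ k≮n) (≤-pred (subst (k <_) (+-comm n 3) k<N))))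
    where
    top : k ≡ n ⊎ k ≡ 1 + n ⊎ k ≡ 2 + n → IsSpecial k
    top (inj₁ k≡)        = # 9 , sym k≡
    top (inj₂ (inj₁ k≡)) = # 10 , sym k≡
    top (inj₂ (inj₂ k≡)) = # 11 , sym k≡

  ∈-S : ∀ {k i} → i ∈ₛ S x k ⇔ InS (toℕ k) (suc (toℕ i))
  ∈-S {k} = ⇔-trans (∈-tabulate {f = λ j → toSide (memb x (toℕ k) (suc (toℕ j)))}) (toSide-inside _)

  ∈-unionOf : ∀ {τ i} → i ∈ₛ unionOf x τ ⇔ (∃ λ k → k ∈ᴺ τ × InS k (suc (toℕ i)))
  ∈-unionOf {τ} {i} = mk⇔
    (λ i∈ → let (f , f∈ , i∈Sf) = find (Any.map⁻ {f = S x} (to (∈-⋃ (map (S x) chosen)) i∈)) in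
            toℕ f , (f , refl , proj₂ (∈-filter⁻ (_∈? τ) {xs = allFin N} f∈)) , to (∈-S {f}) i∈Sf)
    (λ { (_ , (f , refl , f∈τ) , m) → from (∈-⋃ (map (S x) chosen))
           (Any.map⁺ (lose (∈-filter⁺ (_∈? τ) (∈-allFin f) f∈τ) (from (∈-S {f}) m))) })
    where
    chosen : List (Fin N)
    chosen = filter (_∈? τ) (allFin N)

  Low : Bool → Bool → ℕ → Set
  Low hasA hasB e = (T hasA × LowA e) ⊎ (T hasB × LowB e)

  module Regular {C : ℕ → Set} (C? : Decidable C) (C<N : ∀ {k} → C k → k < N) where

    CA CB : ℕ → Set
    CA k = C k × IsA k
    CB k = C k × IsB k

    EA : Extremes CA
    EA = extremes (λ k → C? k ×-dec IsA? k) (C<N ∘ proj₁)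

    EB : Extremes CB
    EB = extremes (λ k → C? k ×-dec IsB? k) (C<N ∘ proj₁)

    InRegular InTails : ℕ → Set
    InRegular e = (∃ λ k → CA k × InS k e) ⊎ (∃ λ k → CB k × InS k e)
    InTails e   = (∃ λ k → CA k × e ∈ˢ interval k (aEnd k))
                ⊎ (∃ λ k → CB k × e ∈ˢ cointerval (bEnd k) k)

    ⋃A : ∀ {a b} → MinMax CA a b →
         ∀ {e} → (∃ λ k → CA k × e ∈ˢ interval k (aEnd k)) ⇔ e ∈ˢ interval a (aEnd b)
    ⋃A mm = ⋃-intervals mm (aEnd-mono ∘ proj₂ ∘ between) (IsA⇒≤aEnd (proj₂ P-lo) (proj₂ P-hi))
      where open MinMax mm

    ⋃B : ∀ {c d} → MinMax CB c d →
         ∀ {e} → (∃ λ k → CB k × e ∈ˢ cointerval (bEnd k) k) ⇔ e ∈ˢ cointerval (bEnd d) c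
    ⋃B mm = ⋃-cointervals mm (λ ck → bEnd-mono (IsB⇒h≤ (proj₂ ck)) (proj₂ (between ck)))
      where open MinMax mm

    tails-shape : Extremes CA → Extremes CB →
                  Σ Shape λ s → s ∈ shapes N × (∀ {e} → InTails e ⇔ e ∈ˢ s)
    tails-shape (none ∅A) (none ∅B) =
      interval 0 0 , interval∈shapes (≤-<-trans z≤n n<N) (≤-<-trans z≤n n<N) ,
      mk⇔ (λ { (inj₁ (_ , ca , _)) → contradiction ca ∅A ; (inj₂ (_ , cb , _)) → contradiction cb ∅B })
          (λ e∈ → contradiction e∈ ∉-empty)
    tails-shape (range {a} {b} mmA) (none ∅B) =
      interval a (aEnd b) , interval∈shapes (C<N (proj₁ P-lo)) (<-trans (aEnd<n (proj₂ P-hi)) n<N) ,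
      ⇔-trans (⊎-dropʳ λ (_ , cb , _) → ∅B cb) (⋃A mmA)
      where open MinMax mmA
    tails-shape (none ∅A) (range {c} {d} mmB) =
      cointerval (bEnd d) c , cointerval∈shapes (bEnd<N (proj₂ P-hi)) (C<N (proj₁ P-lo)) ,
      ⇔-trans (⊎-dropˡ λ (_ , ca , _) → ∅A ca) (⋃B mmB)
      where open MinMax mmB
    tails-shape (range {a} {b} mmA) (range {c} {d} mmB) with c ≤? aEnd b
    ... | yes c≤aEnd[b] = cointerval (bEnd d) a ,
      cointerval∈shapes (bEnd<N (proj₂ (P-hi mmB))) (C<N (proj₁ (P-lo mmA))) ,
      ⇔-trans (⋃A mmA ⊎-⇔ ⋃B mmB)
              (merge-overlapping (IsA<IsB (proj₂ (P-lo mmA)) (proj₂ (P-lo mmB))) c≤aEnd[b])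
      where open MinMax
    ... | no c≰aEnd[b] = cointerval (aEnd b) c ,
      cointerval∈shapes (<-trans (aEnd<n (proj₂ (P-hi mmA))) n<N) (C<N (proj₁ (P-lo mmB))) ,
      ⇔-trans (⋃A mmA ⊎-⇔ ⋃B mmB) (merge-separated a≤bEnd[d] bEnd[d]≤aEnd[b])
      where
      open MinMax
      a≤bEnd[d] : a ≤ bEnd d
      a≤bEnd[d] = begin
        a       ≤⟨ proj₁ (between mmA (P-hi mmA)) ⟩
        b       ≤⟨ aEnd<⇒≤bEnd (proj₂ (P-hi mmA)) (proj₂ (P-lo mmB)) (≰⇒> c≰aEnd[b]) ⟩
        bEnd c  ≤⟨ bEnd-mono (IsB⇒h≤ (proj₂ (P-lo mmB))) (proj₂ (between mmB (P-lo mmB))) ⟩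
        bEnd d  ∎
        where open ≤-Reasoning
      bEnd[d]≤aEnd[b] : bEnd d ≤ aEnd b
      bEnd[d]≤aEnd[b] =
        ≤-trans (bEnd≤1+h (proj₂ (P-hi mmB))) (≤-trans (n≤1+n _) (2+h≤aEnd (proj₂ (P-hi mmA))))

    hasA hasB : Bool
    hasA = nonempty EA
    hasB = nonempty EB

    shape : Shape
    shape = proj₁ (tails-shape EA EB)

    shape∈shapes : shape ∈ shapes N
    shape∈shapes = proj₁ (proj₂ (tails-shape EA EB))

    regular : ∀ {e} → e ≤ n → InRegular e ⇔ (Low hasA hasB e ⊎ (5 ≤ e × e ∈ˢ shape))
    regular {e} e≤n with e <? 5
    ... | yes e<5 = ⇔-trans
      (⇔-trans (∃×-const (λ ca → InS-A-low (proj₂ ca) e<5)) (⇔-sym (T-nonempty EA) ×-⇔ ⇔-id _) ⊎-⇔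
       ⇔-trans (∃×-const (λ cb → InS-B-low (proj₂ cb) e<5)) (⇔-sym (T-nonempty EB) ×-⇔ ⇔-id _))
      (⇔-sym (⊎-dropʳ λ (5≤e , _) → <⇒≱ e<5 5≤e))
    ... | no e≮5 = ⇔-trans
      (∃×-cong (λ ca → InS-A-high (proj₂ ca) 5≤e) ⊎-⇔ ∃×-cong (λ cb → InS-B-high (proj₂ cb) 5≤e e≤n))
      (⇔-trans (proj₂ (proj₂ (tails-shape EA EB))) (⇔-sym (⇔-trans (⊎-dropˡ ¬low) (×-dropˡ 5≤e))))
      where
      5≤e = ≮⇒≥ e≮5
      ¬low : ¬ Low hasA hasB e
      ¬low (inj₁ (_ , low)) = <⇒≱ (LowA⇒<5 low) 5≤e
      ¬low (inj₂ (_ , low)) = <⇒≱ (LowB⇒<5 low) 5≤e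

  Code : Set
  Code = Subset 12 × Bool × Bool × Shape

  Decoded : Code → ℕ → Set
  Decoded (P , hasA , hasB , s) e =
    (∃ λ j → j ∈ₛ P × InS (special j) e) ⊎ Low hasA hasB e ⊎ (5 ≤ e × e ∈ˢ s)

  decoded? : ∀ c e → Dec (Decoded c e)
  decoded? (P , hasA , hasB , s) e =
    any? (λ j → (j ∈? P) ×-dec T? (memb x (special j) e))
    ⊎-dec ((T? hasA ×-dec ((e ≟ 1) ⊎-dec (e ≟ 4))) ⊎-dec (T? hasB ×-dec ((e ≟ 2) ⊎-dec (e ≟ 3))))
    ⊎-dec ((5 ≤? e) ×-dec (e ∈ˢ? s))

  decode : Code → Subset n
  decode c = tabulate (λ i → ⌊ decoded? c (suc (toℕ i)) ⌋)

  codes : List Code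
  codes = cartesianProduct (allSubsets 12) (cartesianProduct bools (cartesianProduct bools (shapes N)))

  module _ {C : ℕ → Set} (C? : Decidable C) (C<N : ∀ {k} → C k → k < N) where
    open Regular C? C<N

    chosenSpecials : Subset 12
    chosenSpecials = tabulate (⌊_⌋ ∘ C? ∘ special)

    InChosenSpecial : ℕ → Set
    InChosenSpecial e = ∃ λ j → j ∈ₛ chosenSpecials × InS (special j) e

    split-by-kind : ∀ {e} → (∃ λ k → C k × InS k e) ⇔ (InChosenSpecial e ⊎ InRegular e)
    split-by-kind {e} = mk⇔ to′
      (λ { (inj₁ (j , j∈ , m))              → special j , to (∈-tabulate-dec (C? ∘ special)) j∈ , m
         ; (inj₂ (inj₁ (k , (ck , _) , m))) → k , ck , m
         ; (inj₂ (inj₂ (k , (ck , _) , m))) → k , ck , m })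
      where
      to′ : (∃ λ k → C k × InS k e) → InChosenSpecial e ⊎ InRegular e
      to′ (k , ck , m) with classify (C<N ck)
      ... | inj₁ (j , refl) = inj₁ (j , from (∈-tabulate-dec (C? ∘ special)) ck , m)
      ... | inj₂ (inj₁ kA)  = inj₂ (inj₁ (k , (ck , kA) , m))
      ... | inj₂ (inj₂ kB)  = inj₂ (inj₂ (k , (ck , kB) , m))

    union-code : ∃ λ c → c ∈ codes × ∀ {e} → e ≤ n → (∃ λ k → C k × InS k e) ⇔ Decoded c e
    union-code =
      (chosenSpecials , hasA , hasB , shape) ,
      ∈-cartesianProduct⁺ (∈-allSubsets _)
        (∈-cartesianProduct⁺ (∈-bools _) (∈-cartesianProduct⁺ (∈-bools _) shape∈shapes)) ,
      λ {e} e≤n → ⇔-trans (split-by-kind {e}) (⇔-id _ ⊎-⇔ regular e≤n)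

  unionOf-decodes : ∀ τ → ∃ λ c → c ∈ codes × unionOf x τ ≡ decode c
  unionOf-decodes τ =
    let (c , c∈ , same) = union-code (_∈ᴺ? τ) ∈ᴺ⇒< in
    c , c∈ , ⊆-antisym (λ i∈ → from (∈-decode c) (to (same (toℕ<n _)) (to ∈-unionOf i∈)))
                       (λ i∈ → from ∈-unionOf (from (same (toℕ<n _)) (to (∈-decode c) i∈)))
    where
    ∈-decode : ∀ c {i} → i ∈ₛ decode c ⇔ Decoded c (suc (toℕ i))
    ∈-decode c = ∈-tabulate-dec (λ i → decoded? c (suc (toℕ i)))

  _≟ₛ_ : DecidableEquality (Subset n)
  _≟ₛ_ = ≡-dec _≟ᴮ_

  unions : List (Subset n)
  unions = deduplicate _≟ₛ_ (map (unionOf x) (allSubsets N))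

  unions-unique : Unique unions
  unions-unique = UniqueDec.deduplicate-! _≟ₛ_ _

  unionOf∈unions : ∀ τ → unionOf x τ ∈ unions
  unionOf∈unions τ = ∈-deduplicate⁺ _≟ₛ_ (∈-map⁺ (unionOf x) (∈-allSubsets τ))

  ∈-unions : ∀ A → A ∈ unions ⇔ InCl x A
  ∈-unions A = mk⇔
    (λ A∈ → let (τ , _ , A≡) = ∈-map⁻ (unionOf x) (∈-deduplicate⁻ _≟ₛ_ _ A∈) in τ , A≡)
    (λ { (τ , refl) → unionOf∈unions τ })

  length-unions≤ : length unions ≤ 2 ^ 17 * n ^ 2
  length-unions≤ = begin
    length unions                          ≤⟨ unique⊆⇒≤length unions-unique unions⊆decoded ⟩
    length (map decode codes)              ≡⟨ length-map decode codes ⟩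
    length codes                           ≡⟨ length-codes ⟩
    2 ^ 12 * (2 * (2 * (N * N + N * N)))
      ≤⟨ *-monoʳ-≤ (2 ^ 12) (*-monoʳ-≤ 2 (*-monoʳ-≤ 2 N²+N²≤8n²)) ⟩
    2 ^ 12 * (2 * (2 * (8 * n ^ 2)))       ≡⟨ e (2 ^ 12) (n ^ 2) ⟩
    2 ^ 12 * 32 * n ^ 2                    ∎
    where
    open ≤-Reasoning
    unions⊆decoded : ∀ {A} → A ∈ unions → A ∈ map decode codes
    unions⊆decoded A∈ =
      let (τ , _ , A≡) = ∈-map⁻ (unionOf x) (∈-deduplicate⁻ _≟ₛ_ (map (unionOf x) (allSubsets N)) A∈)
          (c , c∈ , eq) = unionOf-decodes τ
      in subst (_∈ map decode codes) (sym (trans A≡ eq)) (∈-map⁺ decode c∈)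
    length-codes : length codes ≡ 2 ^ 12 * (2 * (2 * (N * N + N * N)))
    length-codes = begin-equality
      length codes
        ≡⟨ length-cartesianProductWith _,_ (allSubsets 12) flagged ⟩
      length (allSubsets 12) * length flagged
        ≡⟨ cong (length (allSubsets 12) *_) (length-cartesianProductWith _,_ bools (cartesianProduct bools (shapes N))) ⟩
      length (allSubsets 12) * (length bools * length (cartesianProduct bools (shapes N)))
        ≡⟨ cong (λ l → length (allSubsets 12) * (length bools * l)) (length-cartesianProductWith _,_ bools (shapes N)) ⟩
      length (allSubsets 12) * (length bools * (length bools * length (shapes N)))
        ≡⟨ cong (λ l → length (allSubsets 12) * (length bools * (length bools * l))) (length-shapes N) ⟩
      length (allSubsets 12) * (2 * (2 * (N * N + N * N)))
        ≡⟨ cong (_* (2 * (2 * (N * N + N * N)))) (length-allSubsets 12) ⟩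
      2 ^ 12 * (2 * (2 * (N * N + N * N)))  ∎
      where
      flagged : List (Bool × Bool × Shape)
      flagged = cartesianProduct bools (cartesianProduct bools (shapes N))
    N≤n+n : N ≤ n + n
    N≤n+n = +-monoʳ-≤ n (≤-trans (m≤m+n 3 2) (≤-trans 5≤h (<⇒≤ h<n)))
    N²+N²≤8n² : N * N + N * N ≤ 8 * n ^ 2
    N²+N²≤8n² = ≤-trans (+-mono-≤ (*-mono-≤ N≤n+n N≤n+n) (*-mono-≤ N≤n+n N≤n+n)) (≤-reflexive (e′ n))
      where e′ : ∀ n → (n + n) * (n + n) + (n + n) * (n + n) ≡ 8 * (n * (n * 1))
            e′ = solve-∀
    e : ∀ c z → c * (2 * (2 * (8 * z))) ≡ c * 32 * z
    e = solve-∀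

  lowIndex highIndex : Fin (suc y) → ℕ
  lowIndex i  = 5 + toℕ i
  highIndex j = x + 4 + toℕ j

  lowIndex-IsA : ∀ i → IsA (lowIndex i)
  lowIndex-IsA i = m≤m+n 5 (toℕ i) , ≤-trans (+-monoʳ-≤ 5 (≤-pred (toℕ<n i))) (≤-by (y + 1) (e y))
    where e : ∀ y → 5 + y + (y + 1) ≡ 2 * (2 + y) + 2
          e = solve-∀

  highIndex-IsA : ∀ j → IsA (highIndex j)
  highIndex-IsA j = ≤-trans (≤-by (1 + y) (e₁ y)) (m≤m+n (x + 4) (toℕ j)) ,
                    ≤-trans (+-monoʳ-≤ (x + 4) (≤-pred (toℕ<n j))) (≤-reflexive (e₂ y))
    where e₁ : ∀ y → 5 + (1 + y) ≡ 2 + y + 4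
          e₁ = solve-∀
          e₂ : ∀ y → 2 + y + 4 + y ≡ 2 * (2 + y) + 2
          e₂ = solve-∀

  q+2<highIndex : ∀ j → q + 2 < highIndex j
  q+2<highIndex j = ≤-trans (≤-reflexive (e y)) (m≤m+n (x + 4) (toℕ j))
    where e : ∀ y → suc (2 + y + 1 + 2) ≡ 2 + y + 4
          e = solve-∀

  lowIndex≤highIndex : ∀ i j → lowIndex i ≤ highIndex j
  lowIndex≤highIndex i j =
    ≤-trans (+-monoʳ-≤ 5 (≤-pred (toℕ<n i))) (≤-trans (≤-by 1 (e y)) (m≤m+n (x + 4) (toℕ j)))
    where e : ∀ y → 5 + y + 1 ≡ 2 + y + 4
          e = solve-∀

  pairSet : Fin (suc y) → Fin (suc y) → Subset N
  pairSet i j = ⁅ fromℕ< (IsA⇒<N (lowIndex-IsA i)) ⁆ ∪ ⁅ fromℕ< (IsA⇒<N (highIndex-IsA j)) ⁆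

  ∈ᴺ-pairSet : ∀ {i j k} → k ∈ᴺ pairSet i j ⇔ (k ≡ lowIndex i ⊎ k ≡ highIndex j)
  ∈ᴺ-pairSet {i} {j} = ∈ᴺ-pair (IsA⇒<N (lowIndex-IsA i)) (IsA⇒<N (highIndex-IsA j))

  pairSet-IsA : ∀ {i j k} → k ∈ᴺ pairSet i j → IsA k
  pairSet-IsA {i} {j} k∈ =
    Sum.[ (λ { refl → lowIndex-IsA i }) , (λ { refl → highIndex-IsA j }) ] (to ∈ᴺ-pairSet k∈)

  pairSet-minmax : ∀ i j → MinMax (_∈ᴺ pairSet i j) (lowIndex i) (highIndex j)
  pairSet-minmax i j = record
    { P-lo    = from ∈ᴺ-pairSet (inj₁ refl)
    ; P-hi    = from ∈ᴺ-pairSet (inj₂ refl)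
    ; between = λ k∈ → Sum.[ (λ { refl → ≤-refl , lowIndex≤highIndex i j })
                           , (λ { refl → lowIndex≤highIndex i j , ≤-refl }) ] (to ∈ᴺ-pairSet k∈) }

  pairUnion-high : ∀ {i j e} → 5 ≤ e →
    (∃ λ k → k ∈ᴺ pairSet i j × InS k e) ⇔ e ∈ˢ interval (lowIndex i) (aEnd (highIndex j))
  pairUnion-high {i} {j} 5≤e = ⇔-trans (∃×-cong λ k∈ → InS-A-high (pairSet-IsA k∈) 5≤e)
    (⋃-intervals (pairSet-minmax i j) (aEnd-mono ∘ proj₂ ∘ MinMax.between (pairSet-minmax i j))
                 (IsA⇒≤aEnd (lowIndex-IsA i) (highIndex-IsA j)))

  pairUnion : Fin (suc y) × Fin (suc y) → Subset n
  pairUnion (i , j) = unionOf x (pairSet i j)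

  pairUnion-injective : Injective _≡_ _≡_ pairUnion
  pairUnion-injective {i , j} {i′ , j′} eq =
    let (lo≡ , end≡) = interval-endpoints
          (m≤m+n 5 (toℕ i))  (lo<end i j)   (<⇒≤ (aEnd<n (highIndex-IsA j)))
          (m≤m+n 5 (toℕ i′)) (lo<end i′ j′) (<⇒≤ (aEnd<n (highIndex-IsA j′))) same
    in cong₂ _,_ (toℕ-injective (+-cancelˡ-≡ 5 _ _ lo≡))
                 (toℕ-injective (+-cancelˡ-≡ (x + 4) _ _ (+-cancelˡ-≡ h _ _ (begin
                   h + highIndex j          ≡⟨ 3+aEnd-> (q+2<highIndex j) ⟨
                   3 + aEnd (highIndex j)   ≡⟨ cong (3 +_) end≡ ⟩
                   3 + aEnd (highIndex j′)  ≡⟨ 3+aEnd-> (q+2<highIndex j′) ⟩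
                   h + highIndex j′         ∎))))
    where
    open ≡-Reasoning
    lo<end : ∀ i j → lowIndex i < aEnd (highIndex j)
    lo<end i j = ≤-trans (s≤s (proj₂ (lowIndex-IsA i))) (≤-trans (n≤1+n _) (2+h≤aEnd (highIndex-IsA j)))
    same : ∀ {e} → 5 ≤ e → e ≤ n →
      e ∈ˢ interval (lowIndex i) (aEnd (highIndex j)) ⇔ e ∈ˢ interval (lowIndex i′) (aEnd (highIndex j′))
    same 5≤e e≤n =
      ∀-positions {Q = λ e → 5 ≤ e → e ∈ˢ interval (lowIndex i) (aEnd (highIndex j))
                                    ⇔ e ∈ˢ interval (lowIndex i′) (aEnd (highIndex j′))}
        (λ p 5≤e → ⇔-trans (⇔-sym (pairUnion-high {i} {j} 5≤e))
                   (⇔-trans (⇔-sym (∈-unionOf {pairSet i j}))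
                   (⇔-trans (≡⇒⇔ (cong (p ∈ₛ_) eq))
                   (⇔-trans (∈-unionOf {pairSet i′ j′}) (pairUnion-high {i′} {j′} 5≤e)))))
        (≤-trans (s≤s z≤n) 5≤e) e≤n 5≤e

  pairs≤length-unions : suc y * suc y ≤ length unions
  pairs≤length-unions = injection⇒≤length (pairUnion ∘ remQuot {suc y} (suc y)) inj
                          (λ k → unionOf∈unions (uncurry pairSet (remQuot {suc y} (suc y) k)))
    where
    inj : Injective _≡_ _≡_ (pairUnion ∘ remQuot {suc y} (suc y))
    inj {a} {b} eq = begin
      a                                              ≡⟨ combine-remQuot {suc y} (suc y) a ⟨
      uncurry combine (remQuot {suc y} (suc y) a)    ≡⟨ cong (uncurry combine) (pairUnion-injective eq) ⟩
      uncurry combine (remQuot {suc y} (suc y) b)    ≡⟨ combine-remQuot {suc y} (suc y) b ⟩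
      b                                              ∎
      where open ≡-Reasoning

  n²≤144*pairs : n ^ 2 ≤ 144 * (suc y * suc y)
  n²≤144*pairs = ≤-trans (*-mono-≤ n≤12m (*-monoˡ-≤ 1 n≤12m)) (≤-reflexive (e 12 (suc y)))
    where
    n≤12m : n ≤ 12 * suc y
    n≤12m = ≤-by (8 * y) (e′ y)
      where e′ : ∀ y → 4 * (2 + y) + 4 + 8 * y ≡ 12 * suc y
            e′ = solve-∀
    e : ∀ c m → c * m * (c * m * 1) ≡ c * c * (m * m)
    e = solve-∀

  closure-bounds : Σ (List (Subset n)) λ L → Unique L × (∀ A → (A ∈ L) ⇔ InCl x A) ×
                     (n ^ 2 ≤ 144 * length L) × (length L ≤ 2 ^ 17 * n ^ 2)
  closure-bounds = unions , unions-unique , ∈-unions ,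
                   ≤-trans n²≤144*pairs (*-monoʳ-≤ 144 pairs≤length-unions) , length-unions≤

theorem1 : Σ ℕ λ a → Σ ℕ λ b → NonZero a × NonZero b ×
    (∀ x → 2 ≤ x →
      Σ (List (Subset (nn x))) λ L → Unique L × (∀ A → (A ∈ L) ⇔ InCl x A) ×
        (nn x ^ 2 ≤ a * length L) × (length L ≤ b * nn x ^ 2))
theorem1 = 144 , 2 ^ 17 , _ , _ , λ x 2≤x →
  let (y , 2+y≡x) = m≤n⇒∃[o]m+o≡n 2≤x in subst Bounds 2+y≡x (Family.closure-bounds y)
  where
  Bounds : ℕ → Set
  Bounds x = Σ (List (Subset (nn x))) λ L → Unique L × (∀ A → (A ∈ L) ⇔ InCl x A) ×
               (nn x ^ 2 ≤ 144 * length L) × (length L ≤ 2 ^ 17 * nn x ^ 2)
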